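{- Let $S$, $T_{1}$ and $T_{2}$ be pairwise disjoint finite sets with $1\leq |S|\leq |T_{1}|+|T_{2}|$ and $|T_{1}|+\frac{2}{3}|T_{2}|\leq \frac{4}{3}|S|+\frac{1}{3}$, and set $T=T_{1}\cup T_{2}$. Let $G$ be a simple bipartite graph with bipartition $(S,T)$ such that for every $X\subseteq S$, either $|N_{G}(X)\cap T_{1}|+\frac{2}{3}|N_{G}(X)\cap T_{2}|\geq \frac{4}{3}|X|$ or $N_{G}(X)=T$. Then $G$ has an $S$-central path-factor.
   Context: For $U\subseteq V(G)$, $N_{G}(U)=\left(\bigcup_{u\in U}N_{G}(u)\right)\setminus U$. A path-factor of a graph is a spanning subgraph whose components are all paths with at least $2$ vertices. For a bipartite graph $G$ with bipartition $(S,T)$, a subgraph $F$ of $G$ is $S$-central if $S\subseteq V(F)$ and $|V(A)\cap T|\geq |V(A)\cap S|$ for every connected component $A$ of $F$. -}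

module Defs where

open import Data.Nat using (ℕ; zero; suc; _+_; _≤_)
open import Data.Bool using (Bool; true; false; _∧_; _∨_)
open import Data.Fin using (Fin; zero; suc)
open import Data.Fin.Subset using (Subset; _∈_)
open import Data.Vec using (tabulate; lookup)
open import Data.Sum using (_⊎_; inj₁; inj₂)
open import Data.List using (List; length; concat)
open import Data.List.Relation.Unary.All using (All)
open import Data.List.Relation.Unary.Linked using (Linked)
open import Data.List.Relation.Unary.Unique.Propositional using (Unique)
import Data.List.Membership.Propositional as LM
open import Data.Empty using (⊥)
open import Relation.Binary.PropositionalEquality using (_≡_)

TVert : ℕ → ℕ → Set
TVert t₁ t₂ = Fin t₁ ⊎ Fin t₂

Vert : ℕ → ℕ → ℕ → Set
Vert s t₁ t₂ = Fin s ⊎ TVert t₁ t₂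

BipGraph : ℕ → ℕ → ℕ → Set
BipGraph s t₁ t₂ = Fin s → TVert t₁ t₂ → Bool

Adj : ∀ {s t₁ t₂} → BipGraph s t₁ t₂ → Vert s t₁ t₂ → Vert s t₁ t₂ → Set
Adj G (inj₁ x) (inj₂ y) = G x y ≡ true
Adj G (inj₂ y) (inj₁ x) = G x y ≡ true
Adj G (inj₁ _) (inj₁ _) = ⊥
Adj G (inj₂ _) (inj₂ _) = ⊥

anyFin : ∀ {n} → (Fin n → Bool) → Bool
anyFin {zero} f = false
anyFin {suc n} f = f zero ∨ anyFin (λ i → f (suc i))

inN : ∀ {s t₁ t₂} → BipGraph s t₁ t₂ → Subset s → TVert t₁ t₂ → Bool
inN G X y = anyFin (λ x → lookup X x ∧ G x y)

N₁ : ∀ {s t₁ t₂} → BipGraph s t₁ t₂ → Subset s → Subset t₁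
N₁ G X = tabulate (λ j → inN G X (inj₁ j))

N₂ : ∀ {s t₁ t₂} → BipGraph s t₁ t₂ → Subset s → Subset t₂
N₂ G X = tabulate (λ j → inN G X (inj₂ j))

NisT : ∀ {s t₁ t₂} → BipGraph s t₁ t₂ → Subset s → Set
NisT {t₁ = t₁} {t₂} G X = (y : TVert t₁ t₂) → inN G X y ≡ true

countS : ∀ {s t₁ t₂} → List (Vert s t₁ t₂) → ℕ
countS List.[] = 0
countS (inj₁ _ List.∷ vs) = suc (countS vs)
countS (inj₂ _ List.∷ vs) = countS vs

countT : ∀ {s t₁ t₂} → List (Vert s t₁ t₂) → ℕ
countT List.[] = 0
countT (inj₁ _ List.∷ vs) = countT vs
countT (inj₂ _ List.∷ vs) = suc (countT vs)

-- A path-factor of G: a family of vertex-disjoint paths of G (each given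
-- by its vertex sequence, at least 2 vertices, consecutive vertices adjacent
-- in G) covering every vertex; its components are exactly these paths.
record PathFactor {s t₁ t₂} (G : BipGraph s t₁ t₂) : Set where
  field
    paths     : List (List (Vert s t₁ t₂))
    atLeast2  : All (λ p → 2 ≤ length p) paths
    isPath    : All (Linked (Adj G)) paths
    disjoint  : Unique (concat paths)
    spanning  : (v : Vert s t₁ t₂) → v LM.∈ concat paths

-- S-central: every component A has |V(A) ∩ T| ≥ |V(A) ∩ S|
-- (S ⊆ V(F) holds since the factor is spanning).
SCentral : ∀ {s t₁ t₂} {G : BipGraph s t₁ t₂} → PathFactor G → Set
SCentral F = All (λ p → countS p ≤ countT p) (PathFactor.paths F)

module Submission where

-- Replace every s ∈ S by two slots and add d = 2|S| − |T| dummy vertices to T; the first slot of s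
-- may be matched to a T-neighbour of s, the second one also to any dummy.  A set of slots over U ⊆ S
-- either avoids the second copies, and then needs only |U| ≤ |N(U)|, or reaches all d dummies, and
-- then needs 2|U| ≤ |N(U)| + d, which follows from 4|U| ≤ 2|N(U)| + |T₁| and |T₁| ≤ 2d + 1 (the
-- bound 3|T₁| + 2|T₂| ≤ 4|S| + 1).  So Hall's theorem, proved by the Halmos–Vaughan induction (match
-- one vertex to a neighbour, or split along a tight set), gives a perfect matching, a bijection as
-- both sides have 2|S| vertices.  The slots of s then determine a path t – s – t′ or t – s, and these
-- paths form an S-central path-factor: each contains one vertex of S and at least one of T.

open import Algebra.Properties.CommutativeSemigroup using (interchange)
open import Data.Bool using (Bool; true; false; _∧_; _∨_; not; if_then_else_)
open import Data.Bool.Properties using (⇔→≡; ∨-assoc; ∧-comm)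
open import Data.Empty using (⊥; ⊥-elim)
open import Data.Fin using (Fin; zero; suc; _↑ˡ_; _↑ʳ_; splitAt; punchOut; _≟_)
open import Data.Fin.Properties using (any?; pigeonhole; punchOut-injective; +↔⊎; splitAt-↑ˡ; splitAt-↑ʳ)
import Data.Fin.Properties as Finₚ
open import Data.Fin.Subset using (Subset; ∣_∣)
open import Data.Fin.Subset.Properties using (anySubset?)
open import Data.List using (List; []; _∷_; concat)
import Data.List as List
open import Data.List.Membership.Propositional using (_∈_)
open import Data.List.Membership.Propositional.Properties using (∈-tabulate⁺; ∈-concat⁺′)
open import Data.List.Relation.Unary.All using (All; []; _∷_)
import Data.List.Relation.Unary.All.Properties as All
open import Data.List.Relation.Unary.AllPairs using ([]; _∷_)
import Data.List.Relation.Unary.AllPairs.Properties as AllPairs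
open import Data.List.Relation.Unary.Any using (here; there)
open import Data.List.Relation.Unary.Linked using (Linked; [-]; _∷_)
open import Data.List.Relation.Unary.Unique.Propositional using (Unique)
import Data.List.Relation.Unary.Unique.Propositional.Properties as Unique
open import Data.Maybe using (Maybe; just; nothing)
open import Data.Maybe.Properties using (just-injective)
open import Data.Nat using (ℕ; zero; suc; _+_; _*_; _∸_; _≤_; _<_; z≤n; s≤s; _<?_)
open import Data.Nat.Properties hiding (_≟_)
open import Data.Nat.Tactic.RingSolver using (solve-∀)
open import Data.Product using (Σ; ∃; _,_; proj₁; proj₂; _×_)
open import Data.Sum using (_⊎_; inj₁; inj₂; reduce)
open import Data.Sum.Function.Propositional using (_⊎-cong_)
open import Data.Sum.Properties using (inj₁-injective)
open import Data.Vec using (lookup; tabulate)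
open import Data.Vec.Properties using (lookup∘tabulate)
open import Function using (_∘_)
open import Function.Bundles using (_↔_; Inverse; mk⇔)
open import Function.Properties.Inverse using (↔-trans; ↔-refl)
open import Relation.Nullary using (does; yes; no)
open import Relation.Binary.PropositionalEquality

open import Defs

private
  variable
    n m : ℕ
    D : Set

∧-elimˡ : ∀ {a b} → a ∧ b ≡ true → a ≡ true
∧-elimˡ {true} _ = refl

∧-elimʳ : ∀ {a b} → a ∧ b ≡ true → b ≡ true
∧-elimʳ {true} e = e

∧-intro : ∀ {a b} → a ≡ true → b ≡ true → a ∧ b ≡ true
∧-intro refl refl = refl

∨-introˡ : ∀ {a} b → a ≡ true → a ∨ b ≡ true
∨-introˡ _ refl = refl

∨-introʳ : ∀ a {b} → b ≡ true → a ∨ b ≡ true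
∨-introʳ true  _ = refl
∨-introʳ false e = e

∨-elim : ∀ {a b} → a ∨ b ≡ true → a ≡ true ⊎ b ≡ true
∨-elim {true}  _ = inj₁ refl
∨-elim {false} e = inj₂ e

∧-not-elim : ∀ {a b} → a ∧ not b ≡ true → b ≡ false
∧-not-elim {true} {false} _ = refl

true≢false : true ≢ false
true≢false ()

⇔-true⇒≡ : ∀ {a b} → (a ≡ true → b ≡ true) → (b ≡ true → a ≡ true) → a ≡ b
⇔-true⇒≡ to from = ⇔→≡ {z = true} (mk⇔ to from)

-- Boolean predicates on Fin n and their sizes

Pred : ℕ → Set
Pred n = Fin n → Bool

infixr 7 _∩_
infixr 6 _∪_ _─_
infix 4 _⊆_ _≐_

∁ : (D → Bool) → D → Bool
∁ P i = not (P i)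

_∩_ _∪_ _─_ : (D → Bool) → (D → Bool) → D → Bool
(P ∩ Q) i = P i ∧ Q i
(P ∪ Q) i = P i ∨ Q i
P ─ Q = P ∩ ∁ Q

⁅_⁆ : Fin n → Pred n
⁅ x ⁆ i = does (i ≟ x)

_⊆_ : (D → Bool) → (D → Bool) → Set
P ⊆ Q = ∀ {i} → P i ≡ true → Q i ≡ true

_≐_ : (D → Bool) → (D → Bool) → Set
P ≐ Q = ∀ i → P i ≡ Q i

Empty : (D → Bool) → Set
Empty P = ∀ i → P i ≡ false

⊆⇒∩≐ : ∀ {P Q : Pred n} → P ⊆ Q → P ∩ Q ≐ P
⊆⇒∩≐ {P = P} P⊆Q i with P i in e
... | true  = P⊆Q e
... | false = refl

∈⁅⁆ : (x : Fin n) → ⁅ x ⁆ x ≡ true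
∈⁅⁆ zero = refl
∈⁅⁆ (suc x) = ∈⁅⁆ x

∈⁅⁆⇒≡ : ∀ {x i : Fin n} → ⁅ x ⁆ i ≡ true → i ≡ x
∈⁅⁆⇒≡ {x = x} {i} e with i ≟ x | e
... | yes i≡x | _ = i≡x
... | no _    | ()

⁅⁆⊆ : ∀ {P : Pred n} {x} → P x ≡ true → ⁅ x ⁆ ⊆ P
⁅⁆⊆ {P = P} Px i≡x = subst (λ i → P i ≡ true) (sym (∈⁅⁆⇒≡ i≡x)) Px

find : (P : Pred n) → (∃ λ i → P i ≡ true) ⊎ Empty P
find {zero} P = inj₂ λ ()
find {suc n} P with P zero in e | find (P ∘ suc)
... | true  | _                = inj₁ (zero , e)
... | false | inj₁ (i , Psi)   = inj₁ (suc i , Psi)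
... | false | inj₂ none        = inj₂ λ { zero → e ; (suc i) → none i }

bit : Bool → ℕ
bit true  = 1
bit false = 0

count : Pred n → ℕ
count {zero}  P = 0
count {suc n} P = bit (P zero) + count (P ∘ suc)

count-cong : ∀ {P Q : Pred n} → P ≐ Q → count P ≡ count Q
count-cong {zero}  _   = refl
count-cong {suc n} P≐Q = cong₂ _+_ (cong bit (P≐Q zero)) (count-cong (λ i → P≐Q (suc i)))

count-mono : ∀ {P Q : Pred n} → P ⊆ Q → count P ≤ count Q
count-mono {zero} _ = z≤n
count-mono {suc n} {P} {Q} P⊆Q = +-mono-≤ (bit-mono (P zero) (Q zero) P⊆Q) (count-mono λ {i} → P⊆Q {suc i})
  where
  bit-mono : ∀ a b → (a ≡ true → b ≡ true) → bit a ≤ bit b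
  bit-mono true  _ a⇒b rewrite a⇒b refl = ≤-refl
  bit-mono false _ _   = z≤n

count-add : ∀ {P Q R : Pred n} → (∀ i → bit (P i) ≡ bit (Q i) + bit (R i)) → count P ≡ count Q + count R
count-add {zero} _ = refl
count-add {suc n} {P} {Q} {R} e = begin
  bit (P zero) + count (P ∘ suc)                              ≡⟨ cong₂ _+_ (e zero) (count-add (λ i → e (suc i))) ⟩
  (bit (Q zero) + bit (R zero)) + (count (Q ∘ suc) + count (R ∘ suc)) ≡⟨ interchange +-commutativeSemigroup (bit (Q zero)) (bit (R zero)) (count (Q ∘ suc)) (count (R ∘ suc)) ⟩
  (bit (Q zero) + count (Q ∘ suc)) + (bit (R zero) + count (R ∘ suc)) ∎
  where open ≡-Reasoning

count-─∩ : (P Q : Pred n) → count P ≡ count (P ─ Q) + count (P ∩ Q)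
count-─∩ P Q = count-add λ i → split (P i) (Q i)
  where
  split : ∀ a b → bit a ≡ bit (a ∧ not b) + bit (a ∧ b)
  split true  true  = refl
  split true  false = refl
  split false _     = refl

count-∪ : (P Q : Pred n) → count (P ∪ Q) ≡ count (P ─ Q) + count Q
count-∪ P Q = count-add λ i → split (P i) (Q i)
  where
  split : ∀ a b → bit (a ∨ b) ≡ bit (a ∧ not b) + bit b
  split true  true  = refl
  split true  false = refl
  split false true  = refl
  split false false = refl

count-─⊆ : ∀ {P Q : Pred n} → Q ⊆ P → count P ≡ count (P ─ Q) + count Q
count-─⊆ {P = P} {Q} Q⊆P = trans (count-─∩ P Q) (cong (count (P ─ Q) +_) (count-cong (λ i → trans (∧-comm (P i) (Q i)) (⊆⇒∩≐ {P = Q} {P} Q⊆P i))))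

count-empty : ∀ {P : Pred n} → Empty P → count P ≡ 0
count-empty {zero}  _    = refl
count-empty {suc n} none rewrite none zero = count-empty (λ i → none (suc i))

count-full : ∀ {P : Pred n} → (∀ i → P i ≡ true) → count P ≡ n
count-full {zero}  _   = refl
count-full {suc n} full rewrite full zero = cong suc (count-full (λ i → full (suc i)))

count≤n : (P : Pred n) → count P ≤ n
count≤n {n} P = subst (count P ≤_) (count-full {n} {λ _ → true} λ _ → refl) (count-mono {n} {P} {λ _ → true} λ _ → refl)

count-⁅⁆ : (x : Fin n) → count ⁅ x ⁆ ≡ 1
count-⁅⁆ {suc n} zero = cong suc (count-empty {n} λ _ → refl)
count-⁅⁆ {suc n} (suc x) = count-⁅⁆ x

count-─⁅⁆ : ∀ {P : Pred n} {x} → P x ≡ true → count P ≡ suc (count (P ─ ⁅ x ⁆))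
count-─⁅⁆ {P = P} {x} Px = begin
  count P                           ≡⟨ count-─⊆ {P = P} {⁅ x ⁆} (⁅⁆⊆ {P = P} {x} Px) ⟩
  count (P ─ ⁅ x ⁆) + count ⁅ x ⁆   ≡⟨ cong (count (P ─ ⁅ x ⁆) +_) (count-⁅⁆ x) ⟩
  count (P ─ ⁅ x ⁆) + 1             ≡⟨ +-comm _ 1 ⟩
  suc (count (P ─ ⁅ x ⁆))           ∎
  where open ≡-Reasoning

count-pos : ∀ {P : Pred n} {x} → P x ≡ true → 1 ≤ count P
count-pos {P = P} {x} Px = subst (_≤ count P) (count-⁅⁆ x) (count-mono {P = ⁅ x ⁆} {P} (⁅⁆⊆ {P = P} {x} Px))

count-witness : ∀ {P : Pred n} → 1 ≤ count P → ∃ λ i → P i ≡ true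
count-witness {P = P} pos with find P
... | inj₁ w    = w
... | inj₂ none with () ← subst (1 ≤_) (count-empty none) pos

count-++ : ∀ a b (P : Pred (a + b)) → count P ≡ count (P ∘ (_↑ˡ b)) + count (P ∘ (a ↑ʳ_))
count-++ zero    b P = refl
count-++ (suc a) b P = trans (cong (bit (P zero) +_) (count-++ a b (P ∘ suc))) (sym (+-assoc (bit (P zero)) _ _))

anyFin-intro : ∀ (f : Pred n) {i} → f i ≡ true → anyFin f ≡ true
anyFin-intro f {zero}  fi rewrite fi = refl
anyFin-intro f {suc i} fi = ∨-introʳ (f zero) (anyFin-intro (f ∘ suc) fi)

anyFin-witness : ∀ (f : Pred n) → anyFin f ≡ true → ∃ λ i → f i ≡ true
anyFin-witness {suc n} f any with ∨-elim {f zero} any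
... | inj₁ f0   = zero , f0
... | inj₂ rest = let i , fi = anyFin-witness (f ∘ suc) rest in suc i , fi

anyFin-cong : ∀ {f g : Pred n} → f ≐ g → anyFin f ≡ anyFin g
anyFin-cong {zero}  _   = refl
anyFin-cong {suc n} f≐g = cong₂ _∨_ (f≐g zero) (anyFin-cong λ i → f≐g (suc i))

anyFin-++ : ∀ a b (f : Pred (a + b)) → anyFin f ≡ anyFin (f ∘ (_↑ˡ b)) ∨ anyFin (f ∘ (a ↑ʳ_))
anyFin-++ zero    b f = refl
anyFin-++ (suc a) b f = trans (cong (f zero ∨_) (anyFin-++ a b (f ∘ suc))) (sym (∨-assoc (f zero) _ _))

Bigraph : ℕ → ℕ → Set
Bigraph n m = Fin n → Fin m → Bool

N : (Fin n → D → Bool) → Pred n → D → Bool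
N G X y = anyFin λ x → X x ∧ G x y

_↾_ : (Fin n → D → Bool) → (D → Bool) → Fin n → D → Bool
(G ↾ C) x y = G x y ∧ C y

N-intro : (G : Fin n → D → Bool) (X : Pred n) → ∀ {x y} → X x ≡ true → G x y ≡ true → N G X y ≡ true
N-intro G X {y = y} Xx Gxy = anyFin-intro (λ x → X x ∧ G x y) (∧-intro Xx Gxy)

N-witness : (G : Fin n → D → Bool) (X : Pred n) → ∀ {y} → N G X y ≡ true → ∃ λ x → X x ≡ true × G x y ≡ true
N-witness G X {y} NXy = let x , e = anyFin-witness (λ x → X x ∧ G x y) NXy in x , ∧-elimˡ e , ∧-elimʳ e

module _ (G : Fin n → D → Bool) where

  N-cong : ∀ {X Y} → X ≐ Y → N G X ≐ N G Y
  N-cong X≐Y y = anyFin-cong λ x → cong (_∧ G x y) (X≐Y x)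

  N-∪ : ∀ X Y → N G (X ∪ Y) ≐ N G X ∪ N G Y
  N-∪ X Y y = ⇔-true⇒≡ to from
    where
    to : N G (X ∪ Y) y ≡ true → (N G X ∪ N G Y) y ≡ true
    to e with x , XYx , Gxy ← N-witness G (X ∪ Y) e with ∨-elim XYx
    ... | inj₁ Xx = ∨-introˡ (N G Y y) (N-intro G X Xx Gxy)
    ... | inj₂ Yx = ∨-introʳ (N G X y) (N-intro G Y Yx Gxy)
    from : (N G X ∪ N G Y) y ≡ true → N G (X ∪ Y) y ≡ true
    from e with ∨-elim e
    ... | inj₁ NXy = let x , Xx , Gxy = N-witness G X NXy in N-intro G (X ∪ Y) (∨-introˡ (Y x) Xx) Gxy
    ... | inj₂ NYy = let x , Yx , Gxy = N-witness G Y NYy in N-intro G (X ∪ Y) (∨-introʳ (X x) Yx) Gxy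

  N-↾ : ∀ C X → N (G ↾ C) X ≐ N G X ∩ C
  N-↾ C X y = ⇔-true⇒≡ to from
    where
    to : N (G ↾ C) X y ≡ true → (N G X ∩ C) y ≡ true
    to e = let x , Xx , G'xy = N-witness (G ↾ C) X e in ∧-intro (N-intro G X Xx (∧-elimˡ G'xy)) (∧-elimʳ G'xy)
    from : (N G X ∩ C) y ≡ true → N (G ↾ C) X y ≡ true
    from e = let x , Xx , Gxy = N-witness G X (∧-elimˡ e) in N-intro (G ↾ C) X Xx (∧-intro Gxy (∧-elimʳ e))

  N-mono : ∀ {X Y} → X ⊆ Y → N G X ⊆ N G Y
  N-mono {X} {Y} X⊆Y e = let x , Xx , Gxy = N-witness G X e in N-intro G Y (X⊆Y Xx) Gxy

-- Hall's theorem

record Matching (A : Pred n) (G : Bigraph n m) : Set where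
  field
    partner   : Fin n → Maybe (Fin m)
    matched   : ∀ {x} → A x ≡ true → ∃ λ y → partner x ≡ just y × G x y ≡ true
    injective : ∀ {x x′ y} → A x ≡ true → A x′ ≡ true → partner x ≡ just y → partner x′ ≡ just y → x ≡ x′

HallCondition : Pred n → Bigraph n m → Set
HallCondition A G = ∀ X → X ⊆ A → count X ≤ count (N G X)

partner-edge : ∀ {A : Pred n} {G : Bigraph n m} (M : Matching A G) → ∀ {x y} →
               A x ≡ true → Matching.partner M x ≡ just y → G x y ≡ true
partner-edge M Ax p with y , p′ , Gy ← Matching.matched M Ax rewrite just-injective (trans (sym p′) p) = Gy

module _ {G : Bigraph n m} where

  empty-matching : ∀ {A} → Empty A → Matching A G
  empty-matching {A} none = record { partner = λ _ → nothing ; matched = absurd ; injective = λ Ax → absurd Ax }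
    where
    absurd : ∀ {B : Set} {x} → A x ≡ true → B
    absurd {x = x} Ax with () ← trans (sym Ax) (none x)

  edge-matching : ∀ {x y} → G x y ≡ true → Matching ⁅ x ⁆ (G ↾ ⁅ y ⁆)
  edge-matching {x} {y} Gxy = record
    { partner   = λ _ → just y
    ; matched   = λ i≡x → y , refl , ∧-intro (⁅⁆⊆ {P = λ i → G i y} Gxy i≡x) (∈⁅⁆ y)
    ; injective = λ i≡x i′≡x _ _ → trans (∈⁅⁆⇒≡ i≡x) (sym (∈⁅⁆⇒≡ i′≡x))
    }

  matching-glue : ∀ {A A₁ A₂ C} → A ⊆ A₁ ∪ A₂ → Matching A₁ (G ↾ C) → Matching A₂ (G ↾ ∁ C) → Matching A G
  matching-glue {A} {A₁} {A₂} {C} A⊆ M₁ M₂ = record { partner = partner ; matched = matched ; injective = injective }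
    where
    module M₁ = Matching M₁
    module M₂ = Matching M₂
    partner : Fin n → Maybe (Fin m)
    partner x = if A₁ x then M₁.partner x else M₂.partner x
    in₂ : ∀ {x} → A x ≡ true → A₁ x ≡ false → A₂ x ≡ true
    in₂ Ax e with ∨-elim (A⊆ Ax)
    ... | inj₁ A₁x = ⊥-elim (true≢false (trans (sym A₁x) e))
    ... | inj₂ A₂x = A₂x
    matched : ∀ {x} → A x ≡ true → ∃ λ y → partner x ≡ just y × G x y ≡ true
    matched {x} Ax with A₁ x in e
    ... | true  = let y , p , Gy = M₁.matched e in y , p , ∧-elimˡ Gy
    ... | false = let y , p , Gy = M₂.matched (in₂ Ax e) in y , p , ∧-elimˡ Gy
    separated : ∀ {x x′ y} → A₁ x ≡ true → A₂ x′ ≡ true → M₁.partner x ≡ just y → M₂.partner x′ ≡ just y → ⊥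
    separated {x} {x′} {y} e e′ p p′ =
      true≢false (trans (sym (∧-elimʳ {G x y} (partner-edge M₁ e p))) (∧-not-elim {G x′ y} (partner-edge M₂ e′ p′)))
    injective : ∀ {x x′ y} → A x ≡ true → A x′ ≡ true → partner x ≡ just y → partner x′ ≡ just y → x ≡ x′
    injective {x} {x′} Ax Ax′ p p′ with A₁ x in e | A₁ x′ in e′
    ... | true  | true  = M₁.injective e e′ p p′
    ... | false | false = M₂.injective (in₂ Ax e) (in₂ Ax′ e′) p p′
    ... | true  | false = ⊥-elim (separated e (in₂ Ax′ e′) p p′)
    ... | false | true  = ⊥-elim (separated e′ (in₂ Ax e) p′ p)

module _ {G : Bigraph n m} where

  hall-⊆ : ∀ {A X} → HallCondition A G → X ⊆ A → HallCondition X (G ↾ N G X)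
  hall-⊆ {A} {X} H X⊆A Z Z⊆X = begin
    count Z                       ≤⟨ H Z (λ e → X⊆A (Z⊆X e)) ⟩
    count (N G Z)                 ≤⟨ count-mono {P = N G Z} {N G Z ∩ N G X} (λ e → ∧-intro e (N-mono G Z⊆X e)) ⟩
    count (N G Z ∩ N G X)         ≡⟨ count-cong (N-↾ G (N G X) Z) ⟨
    count (N (G ↾ N G X) Z)       ∎
    where open ≤-Reasoning

  hall-contract : ∀ {A X} → HallCondition A G → X ⊆ A → count (N G X) ≤ count X →
                  HallCondition (A ─ X) (G ↾ ∁ (N G X))
  hall-contract {A} {X} H X⊆A tight Z Z⊆A─X = +-cancelʳ-≤ (count X) _ _ (begin
    count Z + count X                       ≡⟨ cong (_+ count X) (count-cong Z─X≐Z) ⟨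
    count (Z ─ X) + count X                 ≡⟨ count-∪ Z X ⟨
    count (Z ∪ X)                           ≤⟨ H (Z ∪ X) Z∪X⊆A ⟩
    count (N G (Z ∪ X))                     ≡⟨ count-cong (N-∪ G Z X) ⟩
    count (N G Z ∪ N G X)                   ≡⟨ count-∪ (N G Z) (N G X) ⟩
    count (N G Z ─ N G X) + count (N G X)   ≤⟨ +-monoʳ-≤ _ tight ⟩
    count (N G Z ─ N G X) + count X         ≡⟨ cong (_+ count X) (count-cong (N-↾ G (∁ (N G X)) Z)) ⟨
    count (N (G ↾ ∁ (N G X)) Z) + count X   ∎)
    where
    open ≤-Reasoning
    Z─X≐Z : Z ─ X ≐ Z
    Z─X≐Z = ⊆⇒∩≐ {P = Z} {∁ X} (λ e → ∧-elimʳ (Z⊆A─X e))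
    Z∪X⊆A : Z ∪ X ⊆ A
    Z∪X⊆A e with ∨-elim e
    ... | inj₁ Zi = ∧-elimˡ (Z⊆A─X Zi)
    ... | inj₂ Xi = X⊆A Xi

  hall-or-violator : (A : Pred n) → HallCondition A G ⊎ ∃ λ X → X ⊆ A × count (N G X) < count X
  hall-or-violator A with anySubset? (λ v → count (N G (lookup v ∩ A)) <? count (lookup v ∩ A))
  ... | yes (v , violation) = inj₂ (lookup v ∩ A , ∧-elimʳ , violation)
  ... | no none = inj₁ λ X X⊆A → ≮⇒≥ λ violation →
          none (tabulate X , subst₂ _<_ (count-cong (N-cong G (λ i → sym (recover X⊆A i)))) (count-cong (λ i → sym (recover X⊆A i))) violation)
    where
    recover : ∀ {X} → X ⊆ A → lookup (tabulate X) ∩ A ≐ X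
    recover {X} X⊆A i = trans (cong (_∧ A i) (lookup∘tabulate X i)) (⊆⇒∩≐ {P = X} {A} X⊆A i)

  hall-neighbour : ∀ {A x} → HallCondition A G → A x ≡ true → ∃ λ y → G x y ≡ true
  hall-neighbour {A} {x} H Ax
    with y , NGxy ← count-witness (≤-trans (count-pos {P = ⁅ x ⁆} {x} (∈⁅⁆ x)) (H ⁅ x ⁆ (⁅⁆⊆ {P = A} Ax)))
    with x′ , x′≡x , Gx′y ← N-witness G ⁅ x ⁆ NGxy
    = y , subst (λ i → G i y ≡ true) (∈⁅⁆⇒≡ x′≡x) Gx′y

  violator-tight : ∀ {X y} → count (N (G ↾ ∁ ⁅ y ⁆) X) < count X → count (N G X) ≤ count X
  violator-tight {X} {y} violation = begin
    count (N G X)                                  ≡⟨ count-─∩ (N G X) ⁅ y ⁆ ⟩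
    count (N G X ─ ⁅ y ⁆) + count (N G X ∩ ⁅ y ⁆) ≤⟨ +-monoʳ-≤ _ at-most-y ⟩
    count (N G X ─ ⁅ y ⁆) + 1                     ≡⟨ +-comm _ 1 ⟩
    suc (count (N G X ─ ⁅ y ⁆))                   ≡⟨ cong suc (count-cong (N-↾ G (∁ ⁅ y ⁆) X)) ⟨
    suc (count (N (G ↾ ∁ ⁅ y ⁆) X))              ≤⟨ violation ⟩
    count X                                        ∎
    where
    open ≤-Reasoning
    at-most-y : count (N G X ∩ ⁅ y ⁆) ≤ 1
    at-most-y = subst (count (N G X ∩ ⁅ y ⁆) ≤_) (count-⁅⁆ y) (count-mono {P = N G X ∩ ⁅ y ⁆} {⁅ y ⁆} λ {i} → ∧-elimʳ {N G X i})

module _ {n m : ℕ} where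

  HallUpTo : ℕ → Set
  HallUpTo k = ∀ {A : Pred n} {G : Bigraph n m} → count A ≤ k → HallCondition A G → Matching A G

  ⊆∪─ : ∀ {A : Pred n} X → A ⊆ X ∪ (A ─ X)
  ⊆∪─ X {i} Ai with X i
  ... | true  = refl
  ... | false rewrite Ai = refl

  matching-from-tight : ∀ {k A G X} → HallUpTo k → count A ≤ suc k → HallCondition A G →
                        X ⊆ A → 1 ≤ count X → count X < count A → count (N G X) ≤ count X → Matching A G
  matching-from-tight {k} {A} {G} {X} hall cA H X⊆A |X|>0 X<A tight =
    matching-glue (⊆∪─ {A = A} X) M₁ M₂
    where
    |X|≤k : count X ≤ k
    |X|≤k = ≤-pred (≤-trans X<A cA)
    |A─X|≤k : count (A ─ X) ≤ k
    |A─X|≤k = ≤-pred (≤-trans (≤-trans (m<m+n (count (A ─ X)) |X|>0) (≤-reflexive (sym (count-─⊆ {P = A} {X} X⊆A)))) cA)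
    M₁ : Matching X (G ↾ N G X)
    M₁ = hall |X|≤k (hall-⊆ {G = G} {A} H X⊆A)
    M₂ : Matching (A ─ X) (G ↾ ∁ (N G X))
    M₂ = hall |A─X|≤k (hall-contract {G = G} H X⊆A tight)

  matching-from-vertex : ∀ {k A G x} → HallUpTo k → count A ≤ suc k → HallCondition A G → A x ≡ true → Matching A G
  matching-from-vertex {k} {A} {G} {x} hall cA H Ax
    with y , Gxy ← hall-neighbour H Ax
    with hall-or-violator {G = G ↾ ∁ ⁅ y ⁆} (A ─ ⁅ x ⁆)
  ... | inj₁ H′ = matching-glue (⊆∪─ {A = A} ⁅ x ⁆) (edge-matching Gxy) (hall |A′|≤k H′)
    where
    |A′|≤k : count (A ─ ⁅ x ⁆) ≤ k
    |A′|≤k = ≤-pred (subst (_≤ suc k) (count-─⁅⁆ {P = A} {x} Ax) cA)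
  ... | inj₂ (X , X⊆A′ , violation) =
    matching-from-tight hall cA H (λ e → ∧-elimˡ (X⊆A′ e)) (≤-trans (s≤s z≤n) violation) X<A (violator-tight {G = G} violation)
    where
    X<A : count X < count A
    X<A = subst (count X <_) (sym (count-─⁅⁆ {P = A} {x} Ax)) (s≤s (count-mono {P = X} {A ─ ⁅ x ⁆} X⊆A′))

  hall-up-to : ∀ k → HallUpTo k
  hall-up-to k {A} cA H with find A
  hall-up-to k       {A} cA H | inj₂ none     = empty-matching none
  hall-up-to zero    {A} cA H | inj₁ (x , Ax) with () ← ≤-trans (count-pos {P = A} {x} Ax) cA
  hall-up-to (suc k) {A} cA H | inj₁ (x , Ax) = matching-from-vertex (hall-up-to k) cA H Ax

  hall-theorem : ∀ {A : Pred n} {G : Bigraph n m} → HallCondition A G → Matching A G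
  hall-theorem {A} = hall-up-to n (count≤n A)

-- Perfect matchings between sets of equal size

injective⇒surjective : ∀ {k l} → l ≤ k → (σ : Fin k → Fin l) → (∀ {i j} → σ i ≡ σ j → i ≡ j) →
                       ∀ r → ∃ λ i → σ i ≡ r
injective⇒surjective {l = suc l} l≤k σ σ-injective r with any? (λ i → σ i ≟ r)
... | yes hit = hit
... | no miss = ⊥-elim (let i , j , i<j , eq = pigeonhole l≤k (λ i → punchOut (σi≢r i)) in
                         Finₚ.<-irrefl (σ-injective (punchOut-injective (σi≢r i) (σi≢r j) eq)) i<j)
  where
  σi≢r : ∀ i → r ≢ σ i
  σi≢r i r≡σi = miss (i , sym r≡σi)

module Assignment {L R : Set} {k l : ℕ} (L↔ : Fin k ↔ L) (R↔ : Fin l ↔ R) (adj : L → R → Bool) (l≤k : l ≤ k)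
  (match : Matching (λ _ → true) (λ i j → adj (Inverse.to L↔ i) (Inverse.to R↔ j))) where

  private
    module L↔ = Inverse L↔
    module R↔ = Inverse R↔
    open Matching match
    σ : Fin k → Fin l
    σ i = proj₁ (matched {i} refl)
    σ-partner : ∀ i → partner i ≡ just (σ i)
    σ-partner i = proj₁ (proj₂ (matched {i} refl))
    σ-injective : ∀ {i j} → σ i ≡ σ j → i ≡ j
    σ-injective {i} {j} eq = injective refl refl (σ-partner i) (trans (σ-partner j) (cong just (sym eq)))

  assign : L → R
  assign x = R↔.to (σ (L↔.from x))

  assign-adj : ∀ x → adj x (assign x) ≡ true
  assign-adj x = subst (λ x′ → adj x′ (assign x) ≡ true) (L↔.strictlyInverseˡ x) (proj₂ (proj₂ (matched refl)))

  assign-injective : ∀ {x x′} → assign x ≡ assign x′ → x ≡ x′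
  assign-injective {x} {x′} eq = begin
    x                      ≡⟨ L↔.strictlyInverseˡ x ⟨
    L↔.to (L↔.from x)      ≡⟨ cong L↔.to (σ-injective (begin
      σ (L↔.from x)                 ≡⟨ R↔.strictlyInverseʳ _ ⟨
      R↔.from (assign x)            ≡⟨ cong R↔.from eq ⟩
      R↔.from (assign x′)           ≡⟨ R↔.strictlyInverseʳ _ ⟩
      σ (L↔.from x′)                ∎)) ⟩
    L↔.to (L↔.from x′)     ≡⟨ L↔.strictlyInverseˡ x′ ⟩
    x′                     ∎
    where open ≡-Reasoning

  assign-surjective : ∀ y → ∃ λ x → assign x ≡ y
  assign-surjective y with i , σi≡ ← injective⇒surjective l≤k σ σ-injective (R↔.from y)
    = L↔.to i , (begin
      R↔.to (σ (L↔.from (L↔.to i)))  ≡⟨ cong (R↔.to ∘ σ) (L↔.strictlyInverseʳ i) ⟩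
      R↔.to (σ i)                    ≡⟨ cong R↔.to σi≡ ⟩
      R↔.to (R↔.from y)              ≡⟨ R↔.strictlyInverseˡ y ⟩
      y                              ∎)
    where open ≡-Reasoning

-- Path-factors from slot assignments

aux : ∀ {s t₁ t₂} d → BipGraph s t₁ t₂ → Fin s ⊎ Fin s → TVert t₁ t₂ ⊎ Fin d → Bool
aux d G (inj₁ a) (inj₁ y) = G a y
aux d G (inj₁ a) (inj₂ _) = false
aux d G (inj₂ a) (inj₁ y) = G a y
aux d G (inj₂ a) (inj₂ _) = true

module PathFactorFromSlots {s t₁ t₂ d} (G : BipGraph s t₁ t₂)
  (ρ : Fin s ⊎ Fin s → TVert t₁ t₂ ⊎ Fin d)
  (ρ-adj : ∀ x → aux d G x (ρ x) ≡ true)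
  (ρ-injective : ∀ {x x′} → ρ x ≡ ρ x′ → x ≡ x′)
  (ρ-covers : ∀ y → ∃ λ x → ρ x ≡ inj₁ y)
  where

  V : Set
  V = Vert s t₁ t₂

  first : ∀ a → ∃ λ y → ρ (inj₁ a) ≡ inj₁ y × G a y ≡ true
  first a with ρ (inj₁ a) | ρ-adj (inj₁ a)
  ... | inj₁ y | Gay = y , refl , Gay

  rest : TVert t₁ t₂ ⊎ Fin d → List V
  rest (inj₁ y) = inj₂ y ∷ []
  rest (inj₂ _) = []

  path : Fin s → List V
  path a = inj₂ (proj₁ (first a)) ∷ inj₁ a ∷ rest (ρ (inj₂ a))

  paths : List (List V)
  paths = List.tabulate path

  path-linked : ∀ a → Linked (Adj G) (path a)
  path-linked a with first a
  ... | _ , _ , Gay with ρ (inj₂ a) | ρ-adj (inj₂ a)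
  ...   | inj₁ y′ | Gay′ = Gay ∷ Gay′ ∷ [-]
  ...   | inj₂ _  | _    = Gay ∷ [-]

  path-central : ∀ a → countS (path a) ≤ countT (path a)
  path-central a with ρ (inj₂ a)
  ... | inj₁ _ = s≤s z≤n
  ... | inj₂ _ = s≤s z≤n

  path-unique : ∀ a → Unique (path a)
  path-unique a with first a
  ... | y , ρ₁≡y , _ with ρ (inj₂ a) in e
  ...   | inj₁ y′ = ((λ ()) ∷ (λ { refl → slots-differ (trans ρ₁≡y (sym e)) }) ∷ []) ∷ ((λ ()) ∷ []) ∷ [] ∷ []
    where
    slots-differ : ρ (inj₁ a) ≢ ρ (inj₂ a)
    slots-differ eq with () ← ρ-injective eq
  ...   | inj₂ _  = ((λ ()) ∷ []) ∷ [] ∷ []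

  owner : V → Fin s
  owner (inj₁ a) = a
  owner (inj₂ y) = reduce (proj₁ (ρ-covers y))

  owner-slot : ∀ {x y} → ρ x ≡ inj₁ y → owner (inj₂ y) ≡ reduce x
  owner-slot {x} {y} ρx≡y = cong reduce (ρ-injective (trans (proj₂ (ρ-covers y)) (sym ρx≡y)))

  ∈path⇒owner : ∀ {a v} → v ∈ path a → owner v ≡ a
  ∈path⇒owner {a} (here refl)                  = owner-slot (proj₁ (proj₂ (first a)))
  ∈path⇒owner     (there (here refl))          = refl
  ∈path⇒owner {a} (there (there v∈rest)) with ρ (inj₂ a) in e
  ... | inj₁ y with here refl ← v∈rest = owner-slot e

  disjoint : Unique (concat paths)
  disjoint = Unique.concat⁺ (All.tabulate⁺ path-unique)
    (AllPairs.tabulate⁺ λ a≢b (v∈a , v∈b) → a≢b (trans (sym (∈path⇒owner v∈a)) (∈path⇒owner v∈b)))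

  spanning : (v : V) → v ∈ concat paths
  spanning (inj₁ a) = ∈-concat⁺′ (there (here refl)) (∈-tabulate⁺ a)
  spanning (inj₂ y) with ρ-covers y
  ... | inj₁ a , ρ₁≡y = ∈-concat⁺′ (here (cong inj₂ (inj₁-injective (trans (sym ρ₁≡y) (proj₁ (proj₂ (first a))))))) (∈-tabulate⁺ a)
  ... | inj₂ a , ρ₂≡y = ∈-concat⁺′ (there (there (∈rest ρ₂≡y))) (∈-tabulate⁺ a)
    where
    ∈rest : ∀ {w} → w ≡ inj₁ y → inj₂ y ∈ rest w
    ∈rest refl = here refl

  factor : PathFactor G
  factor = record
    { paths    = paths
    ; atLeast2 = All.tabulate⁺ λ _ → s≤s (s≤s z≤n)
    ; isPath   = All.tabulate⁺ path-linked
    ; disjoint = disjoint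
    ; spanning = spanning
    }

  factor-central : SCentral factor
  factor-central = All.tabulate⁺ path-central

-- The auxiliary graph

2*-cancel-≤ : ∀ a b → 2 * a ≤ 2 * b + 1 → a ≤ b
2*-cancel-≤ a b 2a≤2b+1 = ≮⇒≥ λ b<a → <-irrefl refl (begin-strict
  2 * b + 1        <⟨ n<1+n _ ⟩
  suc (2 * b + 1)  ≡⟨ double-suc b ⟨
  2 * suc b        ≤⟨ *-monoʳ-≤ 2 b<a ⟩
  2 * a            ≤⟨ 2a≤2b+1 ⟩
  2 * b + 1        ∎)
  where
  open ≤-Reasoning
  double-suc : ∀ b → 2 * suc b ≡ suc (2 * b + 1)
  double-suc = solve-∀

4*≤3*+2*⇒≤+ : ∀ u a b → 4 * u ≤ 3 * a + 2 * b → u ≤ a + b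
4*≤3*+2*⇒≤+ u a b 4u≤ = *-cancelˡ-≤ 4 (begin
  4 * u                          ≤⟨ 4u≤ ⟩
  3 * a + 2 * b                  ≤⟨ m≤m+n _ _ ⟩
  3 * a + 2 * b + (a + 2 * b)    ≡⟨ regroup a b ⟨
  4 * (a + b)                    ∎)
  where
  open ≤-Reasoning
  regroup : ∀ a b → 4 * (a + b) ≡ 3 * a + 2 * b + (a + 2 * b)
  regroup = solve-∀

3a+2b≡2[a+b]+a : ∀ a b → 3 * a + 2 * b ≡ 2 * (a + b) + a
3a+2b≡2[a+b]+a = solve-∀

4a+1≡2[a+a]+1 : ∀ a → 4 * a + 1 ≡ 2 * (a + a) + 1
4a+1≡2[a+a]+1 = solve-∀

weighted-bound⇒≤ : ∀ s t₁ t₂ → 3 * t₁ + 2 * t₂ ≤ 4 * s + 1 → t₁ + t₂ ≤ s + s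
weighted-bound⇒≤ s t₁ t₂ bound = 2*-cancel-≤ (t₁ + t₂) (s + s) (begin
  2 * (t₁ + t₂)               ≤⟨ m≤m+n _ t₁ ⟩
  2 * (t₁ + t₂) + t₁          ≡⟨ 3a+2b≡2[a+b]+a t₁ t₂ ⟨
  3 * t₁ + 2 * t₂             ≤⟨ bound ⟩
  4 * s + 1                   ≡⟨ 4a+1≡2[a+a]+1 s ⟩
  2 * (s + s) + 1             ∎)
  where open ≤-Reasoning

doubled-bound : ∀ s t₁ t₂ d u n₁ n₂ → t₁ + t₂ + d ≡ s + s → 3 * t₁ + 2 * t₂ ≤ 4 * s + 1 →
                n₁ ≤ t₁ → 4 * u ≤ 3 * n₁ + 2 * n₂ → u + u ≤ n₁ + n₂ + d
doubled-bound s t₁ t₂ d u n₁ n₂ t+d≡2s bound n₁≤t₁ 4u≤ = 2*-cancel-≤ (u + u) (n₁ + n₂ + d) (begin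
  2 * (u + u)                    ≡⟨ double-double u ⟩
  4 * u                          ≤⟨ 4u≤ ⟩
  3 * n₁ + 2 * n₂                ≡⟨ 3a+2b≡2[a+b]+a n₁ n₂ ⟩
  2 * (n₁ + n₂) + n₁             ≤⟨ +-monoʳ-≤ _ (≤-trans n₁≤t₁ t₁≤2d+1) ⟩
  2 * (n₁ + n₂) + (2 * d + 1)    ≡⟨ distrib (n₁ + n₂) d ⟩
  2 * (n₁ + n₂ + d) + 1          ∎)
  where
  open ≤-Reasoning
  double-double : ∀ u → 2 * (u + u) ≡ 4 * u
  double-double = solve-∀
  distrib : ∀ a b → 2 * a + (2 * b + 1) ≡ 2 * (a + b) + 1
  distrib = solve-∀
  t₁≤2d+1 : t₁ ≤ 2 * d + 1
  t₁≤2d+1 = +-cancelˡ-≤ (2 * (t₁ + t₂)) t₁ (2 * d + 1) (begin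
    2 * (t₁ + t₂) + t₁            ≡⟨ 3a+2b≡2[a+b]+a t₁ t₂ ⟨
    3 * t₁ + 2 * t₂               ≤⟨ bound ⟩
    4 * s + 1                     ≡⟨ 4a+1≡2[a+a]+1 s ⟩
    2 * (s + s) + 1               ≡⟨ cong (λ x → 2 * x + 1) t+d≡2s ⟨
    2 * (t₁ + t₂ + d) + 1         ≡⟨ distrib (t₁ + t₂) d ⟨
    2 * (t₁ + t₂) + (2 * d + 1)   ∎)

∣tabulate∣ : ∀ {n} (P : Pred n) → ∣ tabulate P ∣ ≡ count P
∣tabulate∣ {zero}  P = refl
∣tabulate∣ {suc n} P with P zero
... | true  = cong suc (∣tabulate∣ (P ∘ suc))
... | false = ∣tabulate∣ (P ∘ suc)

module _ {s t₁ t₂} (G : BipGraph s t₁ t₂) where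

  n₁ n₂ : Pred s → ℕ
  n₁ U = count (N G U ∘ inj₁)
  n₂ U = count (N G U ∘ inj₂)

  Expanding : Pred s → Set
  Expanding U = 4 * count U ≤ 3 * n₁ U + 2 * n₂ U ⊎ (∀ y → N G U y ≡ true)

  expanding : ((X : Subset s) → (4 * ∣ X ∣ ≤ 3 * ∣ N₁ G X ∣ + 2 * ∣ N₂ G X ∣) ⊎ NisT G X) → ∀ U → Expanding U
  expanding hyp U with hyp (tabulate U)
  ... | inj₁ 4X≤ = inj₁ (subst₂ _≤_ (cong (4 *_) (∣tabulate∣ U)) (cong₂ (λ a b → 3 * a + 2 * b) (∣N∣ inj₁) (∣N∣ inj₂)) 4X≤)
    where
    ∣N∣ : ∀ {t} (ι : Fin t → TVert t₁ t₂) → ∣ tabulate (N G (lookup (tabulate U)) ∘ ι) ∣ ≡ count (N G U ∘ ι)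
    ∣N∣ ι = trans (∣tabulate∣ (N G (lookup (tabulate U)) ∘ ι)) (count-cong λ j → N-cong G (lookup∘tabulate U) (ι j))
  ... | inj₂ N≡T = inj₂ λ y → trans (sym (N-cong G (lookup∘tabulate U) y)) (N≡T y)

module AuxiliaryGraph {s t₁ t₂ : ℕ} (d : ℕ) (G : BipGraph s t₁ t₂) where

  slots↔ : Fin (s + s) ↔ (Fin s ⊎ Fin s)
  slots↔ = +↔⊎

  targets↔ : Fin (t₁ + t₂ + d) ↔ (TVert t₁ t₂ ⊎ Fin d)
  targets↔ = ↔-trans +↔⊎ (+↔⊎ ⊎-cong ↔-refl)

  H : Bigraph (s + s) (t₁ + t₂ + d)
  H i j = aux d G (Inverse.to slots↔ i) (Inverse.to targets↔ j)

  module _ (Z : Pred (s + s)) where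

    Z₁ Z₂ U : Pred s
    Z₁ = Z ∘ (_↑ˡ s)
    Z₂ = Z ∘ (s ↑ʳ_)
    U  = Z₁ ∪ Z₂

    dummies : ℕ
    dummies = count (N H Z ∘ ((t₁ + t₂) ↑ʳ_))

    N-H-target : ∀ e → N H Z (e ↑ˡ d) ≡ N G U (splitAt t₁ e)
    N-H-target e = begin
      N H Z (e ↑ˡ d)                                           ≡⟨ anyFin-++ s s _ ⟩
      N (H ∘ (_↑ˡ s)) Z₁ (e ↑ˡ d) ∨ N (H ∘ (s ↑ʳ_)) Z₂ (e ↑ˡ d) ≡⟨ cong₂ _∨_ (anyFin-cong λ a → cong (Z₁ a ∧_) (first-copy a))
                                                                                (anyFin-cong λ a → cong (Z₂ a ∧_) (second-copy a)) ⟩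
      N G Z₁ (splitAt t₁ e) ∨ N G Z₂ (splitAt t₁ e)            ≡⟨ N-∪ G Z₁ Z₂ (splitAt t₁ e) ⟨
      N G U (splitAt t₁ e)                                     ∎
      where
      open ≡-Reasoning
      first-copy : ∀ a → H (a ↑ˡ s) (e ↑ˡ d) ≡ G a (splitAt t₁ e)
      first-copy a rewrite splitAt-↑ˡ s a s | splitAt-↑ˡ (t₁ + t₂) e d = refl
      second-copy : ∀ a → H (s ↑ʳ a) (e ↑ˡ d) ≡ G a (splitAt t₁ e)
      second-copy a rewrite splitAt-↑ʳ s s a | splitAt-↑ˡ (t₁ + t₂) e d = refl

    count-N-H : count (N H Z) ≡ n₁ G U + n₂ G U + dummies
    count-N-H = begin
      count (N H Z)                                          ≡⟨ count-++ (t₁ + t₂) d _ ⟩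
      count (N H Z ∘ (_↑ˡ d)) + dummies                      ≡⟨ cong (_+ dummies) (count-cong N-H-target) ⟩
      count (N G U ∘ splitAt t₁) + dummies                   ≡⟨ cong (_+ dummies) (count-++ t₁ t₂ _) ⟩
      count (λ i → N G U (splitAt t₁ (i ↑ˡ t₂))) + count (λ j → N G U (splitAt t₁ (t₁ ↑ʳ j))) + dummies
        ≡⟨ cong₂ (λ a b → a + b + dummies) (count-cong λ i → cong (N G U) (splitAt-↑ˡ t₁ i t₂))
                                            (count-cong λ j → cong (N G U) (splitAt-↑ʳ t₁ t₂ j)) ⟩
      n₁ G U + n₂ G U + dummies                              ∎
      where open ≡-Reasoning

    all-dummies : ∀ {a} → Z₂ a ≡ true → dummies ≡ d
    all-dummies {a} Z₂a = count-full λ k → N-intro H Z Z₂a (second-copy k)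
      where
      second-copy : ∀ k → H (s ↑ʳ a) ((t₁ + t₂) ↑ʳ k) ≡ true
      second-copy k rewrite splitAt-↑ʳ s s a | splitAt-↑ʳ (t₁ + t₂) d k = refl

  module _ (t+d≡2s : t₁ + t₂ + d ≡ s + s) (s≤t : s ≤ t₁ + t₂) (bound : 3 * t₁ + 2 * t₂ ≤ 4 * s + 1)
           (expand : ∀ U → Expanding G U) where

    neighbour-bounds : ∀ U → count U ≤ n₁ G U + n₂ G U
                           × count U + count U ≤ n₁ G U + n₂ G U + d
    neighbour-bounds U with expand U
    ... | inj₁ 4U≤ = 4*≤3*+2*⇒≤+ (count U) (n₁ G U) (n₂ G U) 4U≤ , doubled-bound s t₁ t₂ d (count U) (n₁ G U) (n₂ G U) t+d≡2s bound (count≤n _) 4U≤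
    ... | inj₂ N≡T rewrite count-full (N≡T ∘ inj₁) | count-full (N≡T ∘ inj₂) =
      ≤-trans (count≤n U) s≤t , ≤-trans (+-mono-≤ (count≤n U) (count≤n U)) (≤-reflexive (sym t+d≡2s))

    aux-hall : HallCondition (λ _ → true) H
    aux-hall Z _ with neighbour-bounds (U Z) | find (Z₂ Z)
    ... | U≤N , _ | inj₂ none = begin
      count Z                                    ≡⟨ count-++ s s Z ⟩
      count (Z₁ Z) + count (Z₂ Z)                ≡⟨ cong (count (Z₁ Z) +_) (count-empty none) ⟩
      count (Z₁ Z) + 0                           ≡⟨ +-identityʳ _ ⟩
      count (Z₁ Z)                               ≤⟨ count-mono (λ {a} → ∨-introˡ (Z₂ Z a)) ⟩
      count (U Z)                                ≤⟨ U≤N ⟩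
      n₁ G (U Z) + n₂ G (U Z)                    ≤⟨ m≤m+n _ _ ⟩
      n₁ G (U Z) + n₂ G (U Z) + dummies Z        ≡⟨ count-N-H Z ⟨
      count (N H Z)                              ∎
      where open ≤-Reasoning
    ... | _ , 2U≤N+d | inj₁ (a , Z₂a) = begin
      count Z                                    ≡⟨ count-++ s s Z ⟩
      count (Z₁ Z) + count (Z₂ Z)                ≤⟨ +-mono-≤ (count-mono (λ {a} → ∨-introˡ (Z₂ Z a))) (count-mono (λ {a} → ∨-introʳ (Z₁ Z a))) ⟩
      count (U Z) + count (U Z)                  ≤⟨ 2U≤N+d ⟩
      n₁ G (U Z) + n₂ G (U Z) + d                ≡⟨ cong (n₁ G (U Z) + n₂ G (U Z) +_) (all-dummies Z Z₂a) ⟨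
      n₁ G (U Z) + n₂ G (U Z) + dummies Z        ≡⟨ count-N-H Z ⟨
      count (N H Z)                              ∎
      where open ≤-Reasoning

lemma1 : (s t₁ t₂ : ℕ) → 1 ≤ s → s ≤ t₁ + t₂
    → 3 * t₁ + 2 * t₂ ≤ 4 * s + 1
    → (G : BipGraph s t₁ t₂)
    → ((X : Subset s) → (4 * ∣ X ∣ ≤ 3 * ∣ N₁ G X ∣ + 2 * ∣ N₂ G X ∣) ⊎ NisT G X)
    → Σ (PathFactor G) SCentral
lemma1 s t₁ t₂ _ s≤t bound G hyp = factor , factor-central
  where
  d : ℕ
  d = s + s ∸ (t₁ + t₂)
  t+d≡2s : t₁ + t₂ + d ≡ s + s
  t+d≡2s = m+[n∸m]≡n (weighted-bound⇒≤ s t₁ t₂ bound)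
  open AuxiliaryGraph d G
  match : Matching (λ _ → true) H
  match = hall-theorem (aux-hall t+d≡2s s≤t bound (expanding G hyp))
  open Assignment slots↔ targets↔ (aux d G) (≤-reflexive t+d≡2s) match
  open PathFactorFromSlots G assign assign-adj assign-injective (assign-surjective ∘ inj₁)
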